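{- Let $M=\langle W,R,U,D,I\rangle$ be a model based on a frame in $\mathscr F(\mathcal C)$, let $w,u\in W$, let $c\in\{\mathsf f,\mathsf b\}$, and let $\mathbf G$ be the set of all $\mathbf G(n,k)\in\mathcal C$. If $M\models w\xrightarrow{L}u$ with $L=L_{S(\mathbf G)}(c)$, then $w\,\rho(c)\,u$.
   Context: A frame is $\langle W,R,U,D\rangle$ with $W\neq\emptyset$, $R\subseteq W\times W$, $U\neq\emptyset$ and $D_w\subseteq U$ for each $w$; a model additionally has an interpretation $I$ (its details are irrelevant here). Frame conditions: $\mathbf D$: every $w$ has some $u$ with $wRu$; $\mathbf G(n,k)$ ($n,k\in\mathbb N$): $wR^nu$ and $wR^kv$ imply $uRv$ ($R^0$ = identity); $\mathbf{ID}$: $wRv\Rightarrow D_w\subseteq D_v$; $\mathbf{DD}$: $wRv\Rightarrow D_v\subseteq D_w$; $\mathbf{CD}$: $D_w=U$ for all $w$; $\mathbf{NE}$: $D_w\neq\emptyset$ for all $w$. $\mathcal C$ is a set of such conditions (assumed closed: any listed condition holding on every frame satisfying $\mathcal C$ is in $\mathcal C$) and $\mathscr F(\mathcal C)$ is the class of frames satisfying all of them. Strings are finite sequences over $\{\mathsf f,\mathsf b\}$. A $\Sigma$-system $S$ is a set of productions $c\to s$ ($c$ a character, $s$ a string); one-step derivation $s'cr'\to s'sr'$; $\to^*_S$ its reflexive-transitive closure; $L_S(s)=\{t: s\to^*_S t\}$. $S(\mathbf G)$ consists of $\mathsf f\to\mathsf b^n\mathsf f^k$ and $\mathsf b\to\mathsf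 b^k\mathsf f^n$ for each $\mathbf G(n,k)\in\mathbf G$. Define $\rho(\mathsf f)=R$, $\rho(\mathsf b)=R^{ -1}$. $M\models w\xrightarrow{c_1\cdots c_m}u$ means there are $w=v_0,\dots,v_m=u$ in $W$ with $v_{i-1}\,\rho(c_i)\,v_i$ (for the empty string, $w=u$); $M\models w\xrightarrow{L}u$ means $M\models w\xrightarrow{s}u$ for some $s\in L$. -}

module Defs where

open import Level using (0ℓ)
open import Data.Nat using (ℕ; zero; suc)
open import Data.List using (List; []; _∷_; _++_; [_]; replicate)
open import Data.Product using (Σ; ∃; ∃-syntax; _×_; _,_)
open import Relation.Binary.PropositionalEquality using (_≡_)
open import Relation.Binary.Construct.Closure.ReflexiveTransitive using (Star)
open import Relation.Nullary using (¬_)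

-- Frames ⟨W,R,U,D⟩ with W ≠ ∅, U ≠ ∅ (witnessed by an element),
-- D w ⊆ U represented as a predicate D w : U → Set.
record Frame : Set₁ where
  field
    W  : Set
    R  : W → W → Set
    U  : Set
    D  : W → U → Set
    w₀ : W
    u₀ : U

RPow : {A : Set} → (A → A → Set) → ℕ → A → A → Set
RPow R zero    x y = x ≡ y
RPow R (suc n) x y = ∃[ z ] (R x z × RPow R n z y)

data Condition : Set where
  D-cond  : Condition
  G-cond  : ℕ → ℕ → Condition
  ID-cond : Condition
  DD-cond : Condition
  CD-cond : Condition
  NE-cond : Condition

Holds : Frame → Condition → Set
Holds F D-cond = ∀ w → ∃[ u ] R w u where open Frame F
Holds F (G-cond n k) = ∀ w u v → RPow R n w u → RPow R k w v → R u v where open Frame F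
Holds F ID-cond = ∀ w v → R w v → ∀ x → D w x → D v x where open Frame F
Holds F DD-cond = ∀ w v → R w v → ∀ x → D v x → D w x where open Frame F
Holds F CD-cond = ∀ w x → D w x where open Frame F
Holds F NE-cond = ∀ w → ∃[ x ] D w x where open Frame F

CondSet : Set₁
CondSet = Condition → Set

InFrameClass : CondSet → Frame → Set
InFrameClass 𝒞 F = ∀ c → 𝒞 c → Holds F c

Closed : CondSet → Set₁
Closed 𝒞 = ∀ c → (∀ F → InFrameClass 𝒞 F → Holds F c) → 𝒞 c

data Char : Set where
  f b : Char

String : Set
String = List Char

data Prod (𝒞 : CondSet) : Char → String → Set where
  prod-f : ∀ {n k} → 𝒞 (G-cond n k) → Prod 𝒞 f (replicate n b ++ replicate k f)
  prod-b : ∀ {n k} → 𝒞 (G-cond n k) → Prod 𝒞 b (replicate k b ++ replicate n f)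

data Step (𝒞 : CondSet) : String → String → Set where
  step : ∀ s' c s r' → Prod 𝒞 c s → Step 𝒞 (s' ++ [ c ] ++ r') (s' ++ s ++ r')

Lang : CondSet → String → String → Set
Lang 𝒞 s t = Star (Step 𝒞) s t

ρ : (F : Frame) → Char → Frame.W F → Frame.W F → Set
ρ F f x y = Frame.R F x y
ρ F b x y = Frame.R F y x

Path : (F : Frame) → Frame.W F → String → Frame.W F → Set
Path F w []       u = w ≡ u
Path F w (c ∷ cs) u = ∃[ v ] (ρ F c w v × Path F v cs u)

PathL : (F : Frame) → Frame.W F → (String → Set) → Frame.W F → Set
PathL F w L u = ∃[ s ] (L s × Path F w s u)

-- A production c → s of S(𝐆) comes from some G(n,k) ∈ 𝒞, and a path along s
-- is a pair of R-chains of lengths n and k out of a common world, so G(n,k)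
-- closes it into a single ρ(c)-edge. Hence every derivation step can be undone
-- on paths, and a path along any word of L_{S(𝐆)}(c) collapses to a ρ(c)-edge.
module Submission where

open import Defs
open import Data.Nat using (zero; suc)
open import Data.List using ([]; _∷_; _++_; [_]; replicate)
open import Data.Product using (∃-syntax; _×_; _,_)
open import Relation.Binary.PropositionalEquality using (refl)
open import Relation.Binary.Construct.Closure.ReflexiveTransitive using (ε; _◅_)

module _ (F : Frame) where
  open Frame F

  RPow-snoc : ∀ n {x y z} → RPow R n x y → R y z → RPow R (suc n) x z
  RPow-snoc zero    refl          yRz = _ , yRz , refl
  RPow-snoc (suc n) (v , xRv , vy) yRz = v , xRv , RPow-snoc n vy yRz

  Path-++⁻ : ∀ s r {x y} → Path F x (s ++ r) y → ∃[ m ] (Path F x s m × Path F m r y)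
  Path-++⁻ []      r p = _ , refl , p
  Path-++⁻ (c ∷ s) r (v , e , p) with Path-++⁻ s r p
  ... | m , p₁ , p₂ = m , (v , e , p₁) , p₂

  Path-++⁺ : ∀ s r {x m y} → Path F x s m → Path F m r y → Path F x (s ++ r) y
  Path-++⁺ []      r refl        q = q
  Path-++⁺ (c ∷ s) r (v , e , p) q = v , e , Path-++⁺ s r p q

  Path-fⁿ⇒RPow : ∀ n {x y} → Path F x (replicate n f) y → RPow R n x y
  Path-fⁿ⇒RPow zero    p           = p
  Path-fⁿ⇒RPow (suc n) (v , e , p) = v , e , Path-fⁿ⇒RPow n p

  Path-bⁿ++⁻ : ∀ n r {x y} → Path F x (replicate n b ++ r) y →
               ∃[ z ] (RPow R n z x × Path F z r y)
  Path-bⁿ++⁻ zero    r p           = _ , refl , p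
  Path-bⁿ++⁻ (suc n) r (v , e , p) with Path-bⁿ++⁻ n r p
  ... | z , zRⁿv , q = z , RPow-snoc n zRⁿv e , q

  Path-bⁿfᵏ⇒G : ∀ n k {x y} → Path F x (replicate n b ++ replicate k f) y →
                ∃[ z ] (RPow R n z x × RPow R k z y)
  Path-bⁿfᵏ⇒G n k p with Path-bⁿ++⁻ n (replicate k f) p
  ... | z , zRⁿx , q = z , zRⁿx , Path-fⁿ⇒RPow k q

  module _ (𝒞 : CondSet) (F∈𝒞 : InFrameClass 𝒞 F) where

    Prod-sound : ∀ {c s x y} → Prod 𝒞 c s → Path F x s y → ρ F c x y
    Prod-sound (prod-f {n} {k} g) p with Path-bⁿfᵏ⇒G n k p
    ... | z , zRⁿx , zRᵏy = F∈𝒞 _ g z _ _ zRⁿx zRᵏy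
    Prod-sound (prod-b {n} {k} g) p with Path-bⁿfᵏ⇒G k n p
    ... | z , zRᵏx , zRⁿy = F∈𝒞 _ g z _ _ zRⁿy zRᵏx

    Step-sound : ∀ {s t x y} → Step 𝒞 s t → Path F x t y → Path F x s y
    Step-sound (step s′ c s r′ pr) p with Path-++⁻ s′ (s ++ r′) p
    ... | m , p₁ , p₂ with Path-++⁻ s r′ p₂
    ... | m′ , q₁ , q₂ = Path-++⁺ s′ ([ c ] ++ r′) p₁ (m′ , Prod-sound pr q₁ , q₂)

    Lang-sound : ∀ {s t x y} → Lang 𝒞 s t → Path F x t y → Path F x s y
    Lang-sound ε          p = p
    Lang-sound (st ◅ sts) p = Step-sound st (Lang-sound sts p)

  Path-[c]⇒ρ : ∀ c {x y} → Path F x [ c ] y → ρ F c x y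
  Path-[c]⇒ρ c (_ , e , refl) = e

mainTheorem15 : (𝒞 : CondSet) → Closed 𝒞 → (F : Frame) → InFrameClass 𝒞 F →
    (w u : Frame.W F) (c : Char) →
    PathL F w (Lang 𝒞 [ c ]) u → ρ F c w u
mainTheorem15 𝒞 _ F F∈𝒞 w u c (t , c⇒t , p) =
  Path-[c]⇒ρ F c (Lang-sound F 𝒞 F∈𝒞 c⇒t p)
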